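{- The stretch function $s:\mathbb{R}\to\mathbb{R}$, $s(\langle a_0a_1a_2\cdots\rangle)=\langle a_0\,0\,0\,a_1\,0\,0\,a_2\,0\,0\cdots\rangle$, is one-tape computable.
   Context: Let $\mathbb{R}$ denote Cantor space $2^\omega$ (its elements are called reals). A one-tape infinite time Turing machine has a single tape, an $\omega$-sequence of cells holding $0$ or $1$, a head, and a program consisting of finitely many states (including special start, halt and limit states) with a transition table which, given the state and the symbol read, specifies the symbol to write, the next state and a left/right move. At successor stages it acts as an ordinary Turing machine (moving left from the leftmost cell leaves the head in place). At limit ordinal stages the head is placed on the leftmost cell, the machine enters the limit state, and each cell takes the value $\limsup$ of its earlier values. On input $a\in\mathbb{R}$, $a$ is written on the tape and the machine starts in the start state on the leftmost cell; if the halt state is reached, the output is the content of the tape. A partial function $f:\mathbb{R}\to\mathbb{R}$ is one-tape computable if some such program halts exactly on the inputs $a\in\mathrm{dom}(f)$, with output $f(a)$. -}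

module Defs where

open import Data.Nat using (ℕ; zero; suc; _*_; _+_; _%_; _/_; _≟_)
open import Relation.Nullary using (yes; no)
open import Data.Bool using (Bool; true; false)
open import Data.Fin using (Fin)
open import Data.Product using (Σ; _×_; _,_; ∃; proj₁; proj₂)
open import Data.Sum using (_⊎_)
open import Relation.Binary.PropositionalEquality using (_≡_)
open import Relation.Nullary using (¬_)
open import Induction.WellFounded using (WellFounded)
open import Level using (0ℓ)

ℝ : Set
ℝ = ℕ → Bool

data Move : Set where
  L R : Move

-- One-tape ITTM program with k states; start, halt and limit states
-- are designated (pairwise distinct) states.
record Program : Set where
  field
    k      : ℕ
    start  : Fin k
    halt   : Fin k
    limit  : Fin k
    start≢halt  : ¬ start ≡ halt
    start≢limit : ¬ start ≡ limit
    halt≢limit  : ¬ halt ≡ limit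
    δ      : Fin k → Bool → Bool × Fin k × Move

record Config (P : Program) : Set where
  constructor conf
  field
    state : Fin (Program.k P)
    head  : ℕ
    tape  : ℕ → Bool

moveHead : Move → ℕ → ℕ
moveHead L zero    = zero
moveHead L (suc n) = n
moveHead R n       = suc n

update : (ℕ → Bool) → ℕ → Bool → (ℕ → Bool)
update t i b j with i ≟ j
... | yes _ = b
... | no _  = t j

step : (P : Program) → Config P → Config P
step P (conf q h t) with Program.δ P q (t h)
... | (b , q' , m) = conf q' (moveHead m h) (update t h b)

_⇔′_ : Set → Set → Set
A ⇔′ B = (A → B) × (B → A)

-- A halting computation of P on input a, presented as a well-ordered
-- set of stages W (the stages 0,…,α for the halting time α) with the
-- configuration at each stage.
record HaltingRun (P : Program) (a : ℝ) : Set₁ where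
  field
    W      : Set
    _<_    : W → W → Set
    <-trans : ∀ {x y z} → x < y → y < z → x < z
    <-irrefl : ∀ {x} → ¬ x < x
    <-total : ∀ x y → x < y ⊎ (x ≡ y ⊎ y < x)
    <-wf   : WellFounded _<_
    c      : W → Config P
    first  : W
    first-least : ∀ w → ¬ w < first
    last   : W
    last-greatest : ∀ w → ¬ last < w
    init   : c first ≡ conf (Program.start P) 0 a
    succ-stage : ∀ v w → v < w → (∀ u → ¬ (v < u × u < w)) → c w ≡ step P (c v)
    -- limit stages (neither first nor successor): head at 0, limit state,
    -- each cell = limsup of its earlier values
    lim-state : ∀ w → ¬ w ≡ first → (∀ v → v < w → Σ W λ u → v < u × u < w) →
                Config.state (c w) ≡ Program.limit P × Config.head (c w) ≡ 0
    lim-tape  : ∀ w → ¬ w ≡ first → (∀ v → v < w → Σ W λ u → v < u × u < w) →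
                ∀ n → (Config.tape (c w) n ≡ true) ⇔′
                  (∀ v → v < w → Σ W λ u → (v ≡ u ⊎ v < u) × u < w × Config.tape (c u) n ≡ true)
    halts  : Config.state (c last) ≡ Program.halt P
    not-halted-before : ∀ w → w < last → ¬ Config.state (c w) ≡ Program.halt P
  output : ℝ
  output = Config.tape (c last)

OneTapeComputable : (ℝ → ℝ) → Set₁
OneTapeComputable f = Σ Program λ P → (a : ℝ) → Σ (HaltingRun P a) λ r →
  (n : ℕ) → HaltingRun.output r n ≡ f a n

stretch : ℝ → ℝ
stretch a n with n % 3
... | zero  = a (n / 3)
... | suc _ = false

{-# OPTIONS --safe #-}
-- The machine works in passes of length ω. Pass 0 inserts a marker 11 after a₀, shifting the
-- rest of the input two cells to the right; every later pass starts at a limit stage, finds the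
-- marker, blanks it and re-inserts it after the next digit. After pass k the tape is
-- a₀ 00 a₁ 00 … a_k 11 a_{k+1} a_{k+2} …, every cell settles within each pass, so these are
-- also the tapes at the limit stages ω·(k+1). At the start of every pass from pass 2 on, cell 2
-- is blank; the machine sets it and clears it again a few steps later. Hence at stage ω·ω every
-- cell except cell 2 has settled to its value in stretch a, while cell 2 holds the limsup 1 of
-- the flashes: reading 0 in cell 1 and 1 in cell 2 (which happens at no earlier limit) the
-- machine clears cell 2 and halts with output stretch a.
module Submission where

open import Defs
open import Data.Bool using (Bool; true; false)
open import Data.Empty using (⊥-elim)
open import Data.Fin as Fin using (Fin; zero; suc; toℕ; fromℕ; inject₁)
import Data.Fin.Induction as Finᵢ
import Data.Fin.Properties as Finₚ
open Finₚ using (toℕ-inject₁; toℕ-fromℕ; toℕ≤pred[n])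
open import Data.Nat using (ℕ; zero; suc; _+_; _*_; _≤_; _<_; _≟_; _<?_; s≤s; z≤n)
open import Data.Nat.DivMod using (_%_; m/n≡1+[m∸n]/n)
open import Data.Nat.GeneralisedArithmetic using (fold; fold-+)
open import Data.Nat.Induction using (<-wellFounded)
open import Data.Nat.Properties
open import Data.Product using (∃; _×_; _,_; proj₁; proj₂)
open import Data.Product.Relation.Binary.Lex.Strict using (×-Lex; ×-transitive; ×-asymmetric; ×-wellFounded)
open import Data.Sum using (_⊎_; inj₁; inj₂)
open import Data.Sum.Relation.Binary.LeftOrder using (_⊎-<_; ₁∼₂; ₁∼₁; ₂∼₂; ⊎-<-transitive; ⊎-<-asymmetric; ⊎-<-wellFounded)
open import Function using (_∘_)
open import Induction.WellFounded using (WellFounded)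
open import Relation.Binary.Definitions using (tri<; tri≈; tri>)
open import Relation.Binary.PropositionalEquality
open import Relation.Nullary using (¬_; yes; no)

Tape : Set
Tape = ℕ → Bool

update-same : ∀ t i b → update t i b i ≡ b
update-same t i b with i ≟ i
... | yes _  = refl
... | no i≢i = ⊥-elim (i≢i refl)

update-other : ∀ t {i j} b → i ≢ j → update t i b j ≡ t j
update-other t {i} {j} b i≢j with i ≟ j
... | yes i≡j = ⊥-elim (i≢j i≡j)
... | no _    = refl

step-δ : ∀ P {q h t b q′ m} → Program.δ P q (t h) ≡ (b , q′ , m) →
         step P (conf q h t) ≡ conf q′ (moveHead m h) (update t h b)
step-δ P eq rewrite eq = refl

overwrite : Tape → ℕ → (ℕ → Bool) → ℕ → Tape
overwrite t h T zero    = t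
overwrite t h T (suc n) = update (overwrite t h T n) (h + n) (T n)

overwrite-below : ∀ t {h} T n {i} → i < h → overwrite t h T n i ≡ t i
overwrite-below t T zero    i<h = refl
overwrite-below t {h} T (suc n) i<h =
  trans (update-other _ (T n) (≢-sym (<⇒≢ (<-≤-trans i<h (m≤m+n h n)))))
        (overwrite-below t T n i<h)

overwrite-beyond : ∀ t h T {n m} → n ≤ m → overwrite t h T n (h + m) ≡ t (h + m)
overwrite-beyond t h T {zero}  n≤m = refl
overwrite-beyond t h T {suc n} n<m =
  trans (update-other _ (T n) (<⇒≢ n<m ∘ +-cancelˡ-≡ h n _))
        (overwrite-beyond t h T (<⇒≤ n<m))

overwrite-written : ∀ t h T {n m} → m < n → overwrite t h T n (h + m) ≡ T m
overwrite-written t h T {suc n} (s≤s m≤n) with m≤n⇒m<n∨m≡n m≤n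
... | inj₂ refl = update-same _ (h + n) (T n)
... | inj₁ m<n  = trans (update-other _ (T n) (≢-sym (<⇒≢ m<n) ∘ +-cancelˡ-≡ h n _))
                        (overwrite-written t h T m<n)

overwrite-agree : ∀ t h T n {m b} → T m ≡ b → t (h + m) ≡ b → overwrite t h T n (h + m) ≡ b
overwrite-agree t h T n {m} Tm≡b tm≡b with m <? n
... | yes m<n = trans (overwrite-written t h T m<n) Tm≡b
... | no m≮n  = trans (overwrite-beyond t h T (≮⇒≥ m≮n)) tm≡b

-- The equation is kept propositional: matching it against refl makes Agda compare runs of the
-- machine unfolded step by step.
data SplitAt (k n : ℕ) : Set where
  below  : n < k → SplitAt k n
  beyond : ∀ m → k + m ≡ n → SplitAt k n

splitAt : ∀ k n → SplitAt k n
splitAt k n with n <? k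
... | yes n<k = below n<k
... | no n≮k  = let (m , k+m≡n) = m≤n⇒∃[o]m+o≡n (≮⇒≥ n≮k) in beyond m k+m≡n

rightSweep : ∀ P (st : ℕ → Fin (Program.k P)) (T : ℕ → Bool) {h t} →
             (∀ m → Program.δ P (st m) (t (h + m)) ≡ (T m , st (suc m) , R)) →
             ∀ n → fold (conf (st 0) h t) (step P) n ≡ conf (st n) (h + n) (overwrite t h T n)
rightSweep P st T {h} {t} moves zero = cong (λ h′ → conf (st 0) h′ t) (sym (+-identityʳ h))
rightSweep P st T {h} {t} moves (suc n) = begin
  step P (fold (conf (st 0) h t) (step P) n)
    ≡⟨ cong (step P) (rightSweep P st T moves n) ⟩
  step P (conf (st n) (h + n) (overwrite t h T n))
    ≡⟨ step-δ P (trans (cong (Program.δ P (st n)) (overwrite-beyond t h T ≤-refl)) (moves n)) ⟩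
  conf (st (suc n)) (suc (h + n)) (overwrite t h T (suc n))
    ≡⟨ cong (λ h′ → conf (st (suc n)) h′ (overwrite t h T (suc n))) (sym (+-suc h n)) ⟩
  conf (st (suc n)) (h + suc n) (overwrite t h T (suc n)) ∎
  where open ≡-Reasoning

Cofinal : (ℕ → Set) → Set
Cofinal Q = ∀ n → ∃ λ m → n ≤ m × Q m

cofinal⇔eventually : ∀ {Q : ℕ → Set} {B : Set} N → (∀ n → Q (N + n) ⇔′ B) → B ⇔′ Cofinal Q
cofinal⇔eventually {Q} {B} N eventually = to , from
  where
  to : B → Cofinal Q
  to b n = N + n , m≤n+m n N , proj₂ (eventually n) b
  from : Cofinal Q → B
  from cofinal with cofinal N
  ... | m , N≤m , qm with m≤n⇒∃[o]m+o≡n N≤m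
  ...   | d , refl = proj₁ (eventually d) qm

limsup-of-settled : ∀ (f : ℕ → Bool) {b} N → (∀ n → f (N + n) ≡ b) → (b ≡ true) ⇔′ Cofinal (λ n → f n ≡ true)
limsup-of-settled f N settled =
  cofinal⇔eventually N λ n → (λ f[N+n] → trans (sym (settled n)) f[N+n]) , trans (settled n)

limsup-of-settled₂ : ∀ (g : ℕ → ℕ → Bool) {b} N → (∀ p n → g (N + p) n ≡ b) →
                  (b ≡ true) ⇔′ Cofinal (λ p → ∃ λ n → g p n ≡ true)
limsup-of-settled₂ g N settled =
  cofinal⇔eventually N λ p → (λ (n , g[N+p]n) → trans (sym (settled p n)) g[N+p]n)
                           , (λ b≡true → 0 , trans (settled p 0) b≡true)

⇔′-trans : ∀ {A B C : Set} → A ⇔′ B → B ⇔′ C → A ⇔′ C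
⇔′-trans (f , f⁻¹) (g , g⁻¹) = g ∘ f , f⁻¹ ∘ g⁻¹

fin-cover⇒toℕ≡suc : ∀ {n} {i j : Fin n} → i Fin.< j → (∀ (u : Fin n) → ¬ (i Fin.< u × u Fin.< j)) → toℕ j ≡ suc (toℕ i)
fin-cover⇒toℕ≡suc {i = i} {j = suc j} (s≤s i≤j) gap with m≤n⇒m<n∨m≡n {toℕ i} {toℕ j} i≤j
... | inj₂ i≡j = cong suc (sym i≡j)
... | inj₁ i<j = ⊥-elim (gap (inject₁ j)
        (subst (_ <_) (sym (toℕ-inject₁ j)) i<j , s≤s (≤-reflexive (toℕ-inject₁ j))))

module ω²-Run (P : Program) (a : ℝ) (limitTape : ℕ → Tape) (ω²Tape : Tape) (k : ℕ) where
  open Program P using (start; halt; limit)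
  open Config

  passStart : ℕ → Config P
  passStart zero    = conf start 0 a
  passStart (suc p) = conf limit 0 (limitTape p)

  atPass : ℕ → ℕ → Config P
  atPass p n = fold (passStart p) (step P) n

  afterω² : ℕ → Config P
  afterω² j = fold (conf limit 0 ω²Tape) (step P) j

  -- The ordinal ω·ω + (k + 1): inj₁ (p , n) is the stage ω·p + n and inj₂ j the stage ω·ω + j.
  Stage : Set
  Stage = (ℕ × ℕ) ⊎ Fin (suc k)

  infix 4 _≺_
  _≺_ : Stage → Stage → Set
  _≺_ = ×-Lex _≡_ _<_ _<_ ⊎-< Fin._<_

  pattern earlierPass p<p′ = ₁∼₁ (inj₁ p<p′)
  pattern samePass n<n′    = ₁∼₁ (inj₂ (refl , n<n′))
  pattern beforeω²         = ₁∼₂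
  pattern afterω²< i<j     = ₂∼₂ i<j

  configAt : Stage → Config P
  configAt (inj₁ (p , n)) = atPass p n
  configAt (inj₂ j)       = afterω² (toℕ j)

  first : Stage
  first = inj₁ (0 , 0)

  last : Stage
  last = inj₂ (fromℕ k)

  ≺-trans : ∀ {u v w} → u ≺ v → v ≺ w → u ≺ w
  ≺-trans = ⊎-<-transitive (×-transitive {_<₂_ = _<_} isEquivalence (resp₂ _<_) <-trans <-trans) Finₚ.<-trans

  ≺-irrefl : ∀ {w} → ¬ w ≺ w
  ≺-irrefl w≺w = ⊎-<-asymmetric (×-asymmetric {_<₂_ = _<_} sym (resp₂ _<_) <-asym <-asym) Finₚ.<-asym w≺w w≺w

  ≺-compare : ∀ v w → v ≺ w ⊎ (v ≡ w ⊎ w ≺ v)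
  ≺-compare (inj₁ (p , n)) (inj₁ (p′ , n′)) with <-cmp p p′ | <-cmp n n′
  ... | tri< p<p′ _ _ | _              = inj₁ (earlierPass p<p′)
  ... | tri> _ _ p′<p | _              = inj₂ (inj₂ (earlierPass p′<p))
  ... | tri≈ _ refl _ | tri< n<n′ _ _  = inj₁ (samePass n<n′)
  ... | tri≈ _ refl _ | tri≈ _ refl _  = inj₂ (inj₁ refl)
  ... | tri≈ _ refl _ | tri> _ _ n′<n  = inj₂ (inj₂ (samePass n′<n))
  ≺-compare (inj₁ _) (inj₂ _) = inj₁ beforeω²
  ≺-compare (inj₂ _) (inj₁ _) = inj₂ (inj₂ beforeω²)
  ≺-compare (inj₂ i) (inj₂ j) with Finₚ.<-cmp i j
  ... | tri< i<j _ _ = inj₁ (afterω²< i<j)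
  ... | tri≈ _ refl _ = inj₂ (inj₁ refl)
  ... | tri> _ _ j<i = inj₂ (inj₂ (afterω²< j<i))

  ≺-wellFounded : WellFounded _≺_
  ≺-wellFounded = ⊎-<-wellFounded (×-wellFounded <-wellFounded <-wellFounded) Finᵢ.<-wellFounded

  first-least : ∀ w → ¬ w ≺ first
  first-least _ (earlierPass ())
  first-least _ (samePass ())

  last-greatest : ∀ w → ¬ last ≺ w
  last-greatest (inj₂ j) (afterω²< k<j) =
    <⇒≱ k<j (subst (toℕ j ≤_) (sym (toℕ-fromℕ k)) (toℕ≤pred[n] j))

  infix 4 _⋖_
  _⋖_ : Stage → Stage → Set
  v ⋖ w = v ≺ w × (∀ u → ¬ (v ≺ u × u ≺ w))

  IsLimit : Stage → Set
  IsLimit w = ∀ v → v ≺ w → ∃ λ u → v ≺ u × u ≺ w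

  ⋖⇒¬limit : ∀ {v w} → v ⋖ w → ¬ IsLimit w
  ⋖⇒¬limit (v≺w , gap) w-limit with w-limit _ v≺w
  ... | u , v≺u , u≺w = gap u (v≺u , u≺w)

  pass-⋖ : ∀ p n → inj₁ (p , n) ⋖ inj₁ (p , suc n)
  pass-⋖ p n = samePass ≤-refl , gap
    where
    gap : ∀ u → ¬ (inj₁ (p , n) ≺ u × u ≺ inj₁ (p , suc n))
    gap _ (earlierPass p<p′ , earlierPass p′<p) = <-asym p<p′ p′<p
    gap _ (earlierPass p<p  , samePass _)       = <-irrefl refl p<p
    gap _ (samePass _       , earlierPass p<p)  = <-irrefl refl p<p
    gap _ (samePass n<n′    , samePass n′<1+n)  = <⇒≱ n<n′ (≤-pred n′<1+n)

  afterω²-⋖ : ∀ j → inj₂ (inject₁ j) ⋖ inj₂ (suc j)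
  afterω²-⋖ j = afterω²< (s≤s (≤-reflexive (toℕ-inject₁ j))) , gap
    where
    gap : ∀ u → ¬ (inj₂ (inject₁ j) ≺ u × u ≺ inj₂ (suc j))
    gap _ (afterω²< j<u , afterω²< u<1+j) =
      <⇒≱ (subst (_< _) (toℕ-inject₁ j) j<u) (≤-pred u<1+j)

  ⋖⇒step : ∀ {v w} → v ⋖ w → configAt w ≡ step P (configAt v)
  ⋖⇒step {inj₁ (p , n)} (earlierPass p<p′ , gap) = ⊥-elim (gap _ (samePass ≤-refl , earlierPass p<p′))
  ⋖⇒step {inj₁ (p , n)} (beforeω² , gap)          = ⊥-elim (gap (inj₁ (p , suc n)) (samePass ≤-refl , beforeω²))
  ⋖⇒step {inj₁ (p , n)} (samePass n<n′ , gap) with m≤n⇒m<n∨m≡n n<n′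
  ... | inj₂ refl   = refl
  ... | inj₁ 1+n<n′ = ⊥-elim (gap _ (samePass ≤-refl , samePass 1+n<n′))
  ⋖⇒step {inj₂ i} {inj₂ j} (afterω²< i<j , gap)
    rewrite fin-cover⇒toℕ≡suc i<j (λ u (i<u , u<j) → gap (inj₂ u) (afterω²< i<u , afterω²< u<j)) = refl

  limit-stage : ∀ w → w ≢ first → IsLimit w → (∃ λ p → w ≡ inj₁ (suc p , 0)) ⊎ w ≡ inj₂ zero
  limit-stage (inj₁ (zero , zero)) w≢first _ = ⊥-elim (w≢first refl)
  limit-stage (inj₁ (suc p , zero)) _ _      = inj₁ (p , refl)
  limit-stage (inj₁ (p , suc n)) _ w-limit   = ⊥-elim (⋖⇒¬limit (pass-⋖ p n) w-limit)
  limit-stage (inj₂ zero) _ _                = inj₂ refl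
  limit-stage (inj₂ (suc j)) _ w-limit       = ⊥-elim (⋖⇒¬limit (afterω²-⋖ j) w-limit)

  CofinallyTrue : Stage → ℕ → Set
  CofinallyTrue w i = ∀ v → v ≺ w → ∃ λ u → (v ≡ u ⊎ v ≺ u) × u ≺ w × tape (configAt u) i ≡ true

  cofinal-in-pass : ∀ p i → Cofinal (λ n → tape (atPass p n) i ≡ true) ⇔′ CofinallyTrue (inj₁ (suc p , 0)) i
  cofinal-in-pass p i = to , from
    where
    to : Cofinal (λ n → tape (atPass p n) i ≡ true) → CofinallyTrue (inj₁ (suc p , 0)) i
    to cofinal (inj₁ (p′ , n′)) (earlierPass p′<1+p) with cofinal (suc n′)
    ... | m , n′<m , true-at-m with m≤n⇒m<n∨m≡n (≤-pred p′<1+p)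
    ...   | inj₁ p′<p  = inj₁ (p , m) , inj₂ (earlierPass p′<p) , earlierPass ≤-refl , true-at-m
    ...   | inj₂ refl = inj₁ (p , m) , inj₂ (samePass n′<m) , earlierPass ≤-refl , true-at-m
    from : CofinallyTrue (inj₁ (suc p , 0)) i → Cofinal (λ n → tape (atPass p n) i ≡ true)
    from cofinal n with cofinal (inj₁ (p , n)) (earlierPass ≤-refl)
    ... | inj₁ (_ , m) , inj₁ refl , _ , true-at-m              = m , ≤-refl , true-at-m
    ... | inj₁ (_ , m) , inj₂ (samePass n<m) , _ , true-at-m    = m , <⇒≤ n<m , true-at-m
    ... | _ , inj₂ (earlierPass p<p′) , earlierPass p′<1+p , _ = ⊥-elim (<⇒≱ p<p′ (≤-pred p′<1+p))

  cofinal-below-ω² : ∀ i → Cofinal (λ p → ∃ λ n → tape (atPass p n) i ≡ true) ⇔′ CofinallyTrue (inj₂ zero) i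
  cofinal-below-ω² i = to , from
    where
    to : Cofinal (λ p → ∃ λ n → tape (atPass p n) i ≡ true) → CofinallyTrue (inj₂ zero) i
    to cofinal (inj₁ (p , _)) beforeω² with cofinal (suc p)
    ... | p′ , p<p′ , n′ , true-at = inj₁ (p′ , n′) , inj₂ (earlierPass p<p′) , beforeω² , true-at
    from : CofinallyTrue (inj₂ zero) i → Cofinal (λ p → ∃ λ n → tape (atPass p n) i ≡ true)
    from cofinal p with cofinal (inj₁ (p , 0)) beforeω²
    ... | inj₁ (_ , n) , inj₁ refl , _ , true-at                  = p , ≤-refl , n , true-at
    ... | inj₁ (_ , n) , inj₂ (samePass _) , _ , true-at          = p , ≤-refl , n , true-at
    ... | inj₁ (p′ , n) , inj₂ (earlierPass p<p′) , _ , true-at   = p′ , <⇒≤ p<p′ , n , true-at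
    ... | inj₂ j , _ , afterω²< () , _

  record Behaviour : Set where
    field
      limitTape-limsup : ∀ p i → (limitTape p i ≡ true) ⇔′ Cofinal (λ n → tape (atPass p n) i ≡ true)
      ω²Tape-limsup    : ∀ i → (ω²Tape i ≡ true) ⇔′ Cofinal (λ p → ∃ λ n → tape (atPass p n) i ≡ true)
      passes-run       : ∀ p n → state (atPass p n) ≢ halt
      tail-runs        : ∀ j → j < k → state (afterω² j) ≢ halt
      tail-halts       : state (afterω² k) ≡ halt

  haltingRun : Behaviour → HaltingRun P a
  haltingRun behaviour = record
    { W = Stage ; _<_ = _≺_ ; <-trans = ≺-trans ; <-irrefl = ≺-irrefl ; <-total = ≺-compare
    ; <-wf = ≺-wellFounded ; c = configAt ; first = first ; first-least = first-least
    ; last = last ; last-greatest = last-greatest ; init = refl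
    ; succ-stage = λ _ _ v≺w gap → ⋖⇒step (v≺w , gap) ; lim-state = lim-state ; lim-tape = lim-tape
    ; halts = subst (λ j → state (afterω² j) ≡ halt) (sym (toℕ-fromℕ k)) tail-halts
    ; not-halted-before = not-halted-before }
    where
    open Behaviour behaviour

    lim-state : ∀ w → w ≢ first → IsLimit w → state (configAt w) ≡ limit × head (configAt w) ≡ 0
    lim-state w w≢first w-limit with limit-stage w w≢first w-limit
    ... | inj₁ (p , refl) = refl , refl
    ... | inj₂ refl       = refl , refl

    lim-tape : ∀ w → w ≢ first → IsLimit w → ∀ i → (tape (configAt w) i ≡ true) ⇔′ CofinallyTrue w i
    lim-tape w w≢first w-limit i with limit-stage w w≢first w-limit
    ... | inj₁ (p , refl) = ⇔′-trans (limitTape-limsup p i) (cofinal-in-pass p i)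
    ... | inj₂ refl       = ⇔′-trans (ω²Tape-limsup i) (cofinal-below-ω² i)

    not-halted-before : ∀ w → w ≺ last → state (configAt w) ≢ halt
    not-halted-before (inj₁ (p , n)) _ = passes-run p n
    not-halted-before (inj₂ j) (afterω²< j<k) = tail-runs (toℕ j) (subst (toℕ j <_) (toℕ-fromℕ k) j<k)

pattern lim      = zero
pattern probe₁   = suc lim
pattern probe₂   = suc probe₁
pattern back₁    = suc probe₂
pattern unflash₂ = suc back₁
pattern scan₀    = suc unflash₂
pattern scan₁    = suc scan₀
pattern scan₂    = suc scan₁
pattern unmark₂  = suc scan₂
pattern insert₀  = suc unmark₂
pattern insert₁  = suc insert₀
pattern insert₂⁰ = suc insert₁
pattern insert₂¹ = suc insert₂⁰
pattern shift⁰⁰  = suc insert₂¹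
pattern shift⁰¹  = suc shift⁰⁰
pattern shift¹⁰  = suc shift⁰¹
pattern shift¹¹  = suc shift¹⁰
pattern halted   = suc shift¹¹

State : Set
State = Fin 18

insert₂ : Bool → State
insert₂ false = insert₂⁰
insert₂ true  = insert₂¹

shift : Bool → Bool → State
shift false false = shift⁰⁰
shift false true  = shift⁰¹
shift true  false = shift¹⁰
shift true  true  = shift¹¹

-- insert₂ x and shift x y hold the one or two digits that have been read but not yet written back.
δ : State → Bool → Bool × State × Move
δ lim      x     = x     , probe₁   , R
δ probe₁   true  = false , unmark₂  , R
δ probe₁   false = false , probe₂   , R
δ probe₂   true  = false , halted   , R
δ probe₂   false = true  , back₁    , L
δ back₁    _     = false , unflash₂ , R
δ unflash₂ _     = false , scan₀    , R
δ scan₀    x     = x     , scan₁    , R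
δ scan₁    true  = false , unmark₂  , R
δ scan₁    false = false , scan₂    , R
δ scan₂    _     = false , scan₀    , R
δ unmark₂  _     = false , insert₀  , R
δ insert₀  x     = x     , insert₁  , R
δ insert₁  x     = true  , insert₂ x , R
δ insert₂⁰ x     = true  , shift false x , R
δ insert₂¹ x     = true  , shift true x  , R
δ shift⁰⁰  x     = false , shift false x , R
δ shift⁰¹  x     = false , shift true x  , R
δ shift¹⁰  x     = true  , shift false x , R
δ shift¹¹  x     = true  , shift true x  , R
δ halted   x     = x     , halted   , R

stretcher : Program
stretcher = record
  { k = 18 ; start = insert₀ ; halt = halted ; limit = lim
  ; start≢halt = λ () ; start≢limit = λ () ; halt≢limit = λ ()
  ; δ = δ }

δ-insert₂ : ∀ x y → δ (insert₂ x) y ≡ (true , shift x y , R)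
δ-insert₂ false y = refl
δ-insert₂ true  y = refl

δ-shift : ∀ x y z → δ (shift x y) z ≡ (x , shift y z , R)
δ-shift false false z = refl
δ-shift false true  z = refl
δ-shift true  false z = refl
δ-shift true  true  z = refl

insert₂≢halted : ∀ x → insert₂ x ≢ halted
insert₂≢halted false ()
insert₂≢halted true  ()

shift≢halted : ∀ x y → shift x y ≢ halted
shift≢halted false false ()
shift≢halted false true  ()
shift≢halted true  false ()
shift≢halted true  true  ()

marked : ℝ → ℕ → Tape
marked a zero    zero                = a 0
marked a zero    (suc zero)          = true
marked a zero    (suc (suc zero))    = true
marked a zero    (suc (suc (suc m))) = a (suc m)
marked a (suc k) zero                = a 0
marked a (suc k) (suc zero)          = false
marked a (suc k) (suc (suc zero))    = false
marked a (suc k) (suc (suc (suc m))) = marked (a ∘ suc) k m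

flagged : ℝ → Tape
flagged a = update (stretch a) 2 true

stretch-3+ : ∀ a m → stretch a (3 + m) ≡ stretch (a ∘ suc) m
stretch-3+ a m with m % 3
... | zero  = cong a (m/n≡1+[m∸n]/n {3 + m} {3} (s≤s (s≤s (s≤s z≤n))))
... | suc _ = refl

marked≡stretch : ∀ a k {i} → i < k * 3 → marked a k i ≡ stretch a i
marked≡stretch a (suc k) {zero}              _ = refl
marked≡stretch a (suc k) {suc zero}          _ = refl
marked≡stretch a (suc k) {suc (suc zero)}    _ = refl
marked≡stretch a (suc k) {suc (suc (suc m))} (s≤s (s≤s (s≤s m<3k))) =
  trans (marked≡stretch (a ∘ suc) k m<3k) (sym (stretch-3+ a m))

inserting : ℝ → ℕ → State
inserting b zero                = insert₀
inserting b (suc zero)          = insert₁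
inserting b (suc (suc zero))    = insert₂ (b 1)
inserting b (suc (suc (suc m))) = shift (b (suc m)) (b (suc (suc m)))

scanning : ℝ → ℕ → ℕ → State
scanning b k       zero                = scan₀
scanning b k       (suc zero)          = scan₁
scanning b zero    (suc (suc zero))    = unmark₂
scanning b (suc k) (suc (suc zero))    = scan₂
scanning b zero    (suc (suc (suc m))) = inserting (b ∘ suc) m
scanning b (suc k) (suc (suc (suc m))) = scanning (b ∘ suc) k m

unmarking : ℝ → ℕ → State
unmarking a zero                = lim
unmarking a (suc zero)          = probe₁
unmarking a (suc (suc zero))    = unmark₂
unmarking a (suc (suc (suc m))) = inserting (a ∘ suc) m

δ-inserting : ∀ b m → δ (inserting b m) (b m) ≡ (marked b 0 m , inserting b (suc m) , R)
δ-inserting b zero                = refl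
δ-inserting b (suc zero)          = refl
δ-inserting b (suc (suc zero))    = δ-insert₂ (b 1) (b 2)
δ-inserting b (suc (suc (suc m))) = δ-shift (b (suc m)) (b (suc (suc m))) (b (suc (suc (suc m))))

δ-scanning : ∀ b k m → δ (scanning b k m) (marked b k m) ≡ (marked b (suc k) m , scanning b k (suc m) , R)
δ-scanning b zero    zero                = refl
δ-scanning b zero    (suc zero)          = refl
δ-scanning b zero    (suc (suc zero))    = refl
δ-scanning b zero    (suc (suc (suc m))) = δ-inserting (b ∘ suc) m
δ-scanning b (suc k) zero                = refl
δ-scanning b (suc k) (suc zero)          = refl
δ-scanning b (suc k) (suc (suc zero))    = refl
δ-scanning b (suc k) (suc (suc (suc m))) = δ-scanning (b ∘ suc) k m

δ-unmarking : ∀ a m → δ (unmarking a m) (marked a 0 m) ≡ (marked a 1 m , unmarking a (suc m) , R)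
δ-unmarking a zero                = refl
δ-unmarking a (suc zero)          = refl
δ-unmarking a (suc (suc zero))    = refl
δ-unmarking a (suc (suc (suc m))) = δ-inserting (a ∘ suc) m

inserting≢halted : ∀ b m → inserting b m ≢ halted
inserting≢halted b zero                ()
inserting≢halted b (suc zero)          ()
inserting≢halted b (suc (suc zero))    = insert₂≢halted (b 1)
inserting≢halted b (suc (suc (suc m))) = shift≢halted _ _

scanning≢halted : ∀ b k m → scanning b k m ≢ halted
scanning≢halted b k       zero                ()
scanning≢halted b k       (suc zero)          ()
scanning≢halted b zero    (suc (suc zero))    ()
scanning≢halted b (suc k) (suc (suc zero))    ()
scanning≢halted b zero    (suc (suc (suc m))) = inserting≢halted (b ∘ suc) m
scanning≢halted b (suc k) (suc (suc (suc m))) = scanning≢halted (b ∘ suc) k m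

unmarking≢halted : ∀ a m → unmarking a m ≢ halted
unmarking≢halted a zero                ()
unmarking≢halted a (suc zero)          ()
unmarking≢halted a (suc (suc zero))    ()
unmarking≢halted a (suc (suc (suc m))) = inserting≢halted (a ∘ suc) m

module StretcherRun (a : ℝ) where
  open ω²-Run stretcher a (marked a) (flagged a) 3
  open Config

  at-cell : ∀ {c c′ : Config stretcher} → c ≡ c′ → ∀ i → tape c i ≡ tape c′ i
  at-cell eq i = cong (λ c → tape c i) eq

  pass₀ : ∀ n → atPass 0 n ≡ conf (inserting a n) n (overwrite a 0 (marked a 0) n)
  pass₀ = rightSweep stretcher (inserting a) (marked a 0) (δ-inserting a)

  pass₁ : ∀ n → atPass 1 n ≡ conf (unmarking a n) n (overwrite (marked a 0) 0 (marked a 1) n)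
  pass₁ = rightSweep stretcher (unmarking a) (marked a 1) (δ-unmarking a)

  afterFlash : ℕ → Tape
  afterFlash q = tape (atPass (suc (suc q)) 5)

  later-pass : ∀ q n → atPass (suc (suc q)) (5 + n) ≡
               conf (scanning (a ∘ suc) q n) (3 + n) (overwrite (afterFlash q) 3 (marked (a ∘ suc) (suc q)) n)
  later-pass q n = begin
    fold (passStart (suc (suc q))) (step stretcher) (5 + n)
      ≡⟨ cong (fold (passStart (suc (suc q))) (step stretcher)) (+-comm 5 n) ⟩
    fold (passStart (suc (suc q))) (step stretcher) (n + 5)
      ≡⟨ fold-+ (passStart (suc (suc q))) (step stretcher) n ⟩
    fold (atPass (suc (suc q)) 5) (step stretcher) n
      ≡⟨ rightSweep stretcher (scanning (a ∘ suc) q) (marked (a ∘ suc) (suc q)) (δ-scanning (a ∘ suc) q) n ⟩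
    conf (scanning (a ∘ suc) q n) (3 + n) (overwrite (afterFlash q) 3 (marked (a ∘ suc) (suc q)) n) ∎
    where open ≡-Reasoning

  later-pass-below : ∀ q n {i} → i < 3 → tape (atPass (suc (suc q)) (5 + n)) i ≡ afterFlash q i
  later-pass-below q n {i} i<3 =
    trans (at-cell (later-pass q n) i) (overwrite-below (afterFlash q) (marked (a ∘ suc) (suc q)) n i<3)

  pass-settles : ∀ p i → ∃ λ N → ∀ n → tape (atPass p (N + n)) i ≡ marked a p i
  pass-settles 0 i = suc i , λ n →
    trans (at-cell (pass₀ (suc i + n)) i) (overwrite-written a 0 (marked a 0) (s≤s (m≤m+n i n)))
  pass-settles 1 i = suc i , λ n →
    trans (at-cell (pass₁ (suc i + n)) i) (overwrite-written (marked a 0) 0 (marked a 1) (s≤s (m≤m+n i n)))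
  pass-settles (suc (suc q)) 0 = 5 , λ n → later-pass-below q n (s≤s z≤n)
  pass-settles (suc (suc q)) 1 = 5 , λ n → later-pass-below q n (s≤s (s≤s z≤n))
  pass-settles (suc (suc q)) 2 = 5 , λ n → later-pass-below q n (s≤s (s≤s (s≤s z≤n)))
  pass-settles (suc (suc q)) i@(suc (suc (suc m))) = 5 + suc m , λ n → begin
    tape (atPass (suc (suc q)) (5 + suc m + n)) i
      ≡⟨ cong (λ k → tape (atPass (suc (suc q)) k) i) (+-assoc 5 (suc m) n) ⟩
    tape (atPass (suc (suc q)) (5 + (suc m + n))) i
      ≡⟨ at-cell (later-pass q (suc m + n)) i ⟩
    overwrite (afterFlash q) 3 (marked (a ∘ suc) (suc q)) (suc m + n) (3 + m)
      ≡⟨ overwrite-written (afterFlash q) 3 (marked (a ∘ suc) (suc q)) (s≤s (m≤m+n m n)) ⟩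
    marked (a ∘ suc) (suc q) m ∎
    where open ≡-Reasoning

  before-sweep : ∀ q n {i} → n < 5 → i ≢ 2 → tape (atPass (suc (suc q)) n) i ≡ marked a (suc q) i
  before-sweep q n {2}                 _ i≢2 = ⊥-elim (i≢2 refl)
  before-sweep q 0 _ _ = refl
  before-sweep q 1 {0}                 _ _ = refl
  before-sweep q 1 {1}                 _ _ = refl
  before-sweep q 1 {suc (suc (suc m))} _ _ = refl
  before-sweep q 2 {0}                 _ _ = refl
  before-sweep q 2 {1}                 _ _ = refl
  before-sweep q 2 {suc (suc (suc m))} _ _ = refl
  before-sweep q 3 {0}                 _ _ = refl
  before-sweep q 3 {1}                 _ _ = refl
  before-sweep q 3 {suc (suc (suc m))} _ _ = refl
  before-sweep q 4 {0}                 _ _ = refl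
  before-sweep q 4 {1}                 _ _ = refl
  before-sweep q 4 {suc (suc (suc m))} _ _ = refl
  before-sweep q (suc (suc (suc (suc (suc n))))) (s≤s (s≤s (s≤s (s≤s (s≤s ()))))) _

  swept-cell : ∀ q n {i} → i < suc q * 3 → i ≢ 2 → tape (atPass (suc (suc q)) (5 + n)) i ≡ stretch a i
  swept-cell q n {0}                 _ _   = later-pass-below q n (s≤s z≤n)
  swept-cell q n {1}                 _ _   = later-pass-below q n (s≤s (s≤s z≤n))
  swept-cell q n {2}                 _ i≢2 = ⊥-elim (i≢2 refl)
  swept-cell q n {i@(suc (suc (suc m)))} (s≤s (s≤s (s≤s m<3q))) _ = begin
    tape (atPass (suc (suc q)) (5 + n)) i
      ≡⟨ at-cell (later-pass q n) i ⟩
    overwrite (afterFlash q) 3 (marked (a ∘ suc) (suc q)) n (3 + m)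
      ≡⟨ overwrite-agree (afterFlash q) 3 (marked (a ∘ suc) (suc q)) n
           (marked≡stretch (a ∘ suc) (suc q) (<-≤-trans m<3q (m≤n+m (q * 3) 3)))
           (marked≡stretch (a ∘ suc) q m<3q) ⟩
    stretch (a ∘ suc) m
      ≡⟨ stretch-3+ a m ⟨
    stretch a (3 + m) ∎
    where open ≡-Reasoning

  late-pass-cell : ∀ q n {i} → i < suc q * 3 → i ≢ 2 → tape (atPass (suc (suc q)) n) i ≡ stretch a i
  late-pass-cell q n {i} i<3q+3 i≢2 with splitAt 5 n
  ... | below n<5 = trans (before-sweep q n n<5 i≢2) (marked≡stretch a (suc q) i<3q+3)
  ... | beyond n′ 5+n′≡n =
    subst (λ n → tape (atPass (suc (suc q)) n) i ≡ stretch a i) 5+n′≡n (swept-cell q n′ i<3q+3 i≢2)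

  ω²-limsup : ∀ i → (flagged a i ≡ true) ⇔′ Cofinal (λ p → ∃ λ n → tape (atPass p n) i ≡ true)
  ω²-limsup i with i ≟ 2
  ... | yes refl = (λ _ p → 2 + p , m≤n+m p 2 , 3 , refl) , (λ _ → refl)
  ... | no i≢2   = limsup-of-settled₂ (λ p n → tape (atPass p n) i) (2 + i) settled
    where
    settled : ∀ p n → tape (atPass (2 + i + p) n) i ≡ flagged a i
    settled p n = trans (late-pass-cell (i + p) n (<-≤-trans (s≤s (m≤m+n i p)) (m≤m*n (suc (i + p)) 3)) i≢2)
                        (sym (update-other (stretch a) true (i≢2 ∘ sym)))

  before-sweep-running : ∀ q n → n < 5 → state (atPass (suc (suc q)) n) ≢ halted
  before-sweep-running q 0 _ ()
  before-sweep-running q 1 _ ()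
  before-sweep-running q 2 _ ()
  before-sweep-running q 3 _ ()
  before-sweep-running q 4 _ ()
  before-sweep-running q (suc (suc (suc (suc (suc n))))) (s≤s (s≤s (s≤s (s≤s (s≤s ())))))

  passes-run : ∀ p n → state (atPass p n) ≢ halted
  passes-run 0 n = inserting≢halted a n ∘ trans (cong state (sym (pass₀ n)))
  passes-run 1 n = unmarking≢halted a n ∘ trans (cong state (sym (pass₁ n)))
  passes-run (suc (suc q)) n with splitAt 5 n
  ... | below n<5 = before-sweep-running q n n<5
  ... | beyond n′ 5+n′≡n =
    subst (λ n → state (atPass (suc (suc q)) n) ≢ halted) 5+n′≡n
          (scanning≢halted (a ∘ suc) q n′ ∘ trans (cong state (sym (later-pass q n′))))

  tail-runs : ∀ j → j < 3 → state (afterω² j) ≢ halted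
  tail-runs 0 _ ()
  tail-runs 1 _ ()
  tail-runs 2 _ ()
  tail-runs (suc (suc (suc j))) (s≤s (s≤s (s≤s ())))

  behaviour : Behaviour
  behaviour = record
    { limitTape-limsup = λ p i → let (N , settled) = pass-settles p i in
                                 limsup-of-settled (λ n → tape (atPass p n) i) N settled
    ; ω²Tape-limsup    = ω²-limsup
    ; passes-run       = passes-run
    ; tail-runs        = tail-runs
    ; tail-halts       = refl }

  run : HaltingRun stretcher a
  run = haltingRun behaviour

  output-is-stretch : ∀ i → HaltingRun.output run i ≡ stretch a i
  output-is-stretch 0                   = refl
  output-is-stretch 1                   = refl
  output-is-stretch 2                   = refl
  output-is-stretch (suc (suc (suc m))) = refl

mainTheorem2 : OneTapeComputable stretch
mainTheorem2 = stretcher , λ a → StretcherRun.run a , StretcherRun.output-is-stretch a
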